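{- Let $F$ be a Boolean function over $X$ and $T$ a vtree for $X$ in which every non-leaf node has two children. Let $v\in T$ and $\mathcal{H}\subseteq\mathsf{factors}(F,X_v)$. Then $C_{v,\mathcal{H}}$ is a canonical SDD respecting the vtree $T_v$, and $C_{v,\mathcal{H}}$ computes $\bigvee_{H\in\mathcal{H}}H$.
   Context: Boolean functions: $F\colon\{0,1\}^X\to\{0,1\}$, $\mathsf{sat}(F)=F^{ -1}(1)$. For $Y$ a set of variables and $b\colon Y\cap X\to\{0,1\}$, the cofactor $F(b,X\setminus Y)$ is $b'\mapsto F(b\cup b')$. A function $G$ on $\{0,1\}^{Y\cap X}$ is a factor of $F$ relative to $Y$ if for some cofactor $F'$ induced by an assignment of $Y\cap X$, $G(b)=1$ iff $F(b,X\setminus Y)=F'$; $\mathsf{factors}(F,Y)$ is the set of factors. For disjoint $Y,Y'\subseteq X$ and $H\in\mathsf{factors}(F,Y\cup Y')$, $\mathsf{impl}(F,H,Y,Y')$ is the set of pairs $(G,G')\in\mathsf{factors}(F,Y)\times\mathsf{factors}(F,Y')$ with $\mathsf{sat}(G)\times\mathsf{sat}(G')\subseteq\mathsf{sat}(H)$ ($B\times B'=\{b\cup b'\}$). Circuits: DAGs with input gates labelled by distinct variables or constants $\bot,\top$, internal unbounded-fanin $\wedge,\vee$ and fanin-1 $\neg$ gates; NNF: $\neg$ only on inputs; $\mathsf{var}(C_g)$ variables of subcircuit at $g$; deterministic: inputs of each $\vee$-gate have pairwise disjoint models. Vtree for $Y$: rooted ordered binary tree with leaves in bijection with $Y$; $T_v$,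 $Y_v$ subtree at $v$ and its leaves. A fanin-2 $\wedge$-gate with inputs $h,h'$ is structured by node $v$ with children $v_l,v_r$ if $\mathsf{var}(C_h)\subseteq Y_{v_l}$, $\mathsf{var}(C_{h'})\subseteq Y_{v_r}$. An SDD structured by a vtree $T$ for $Y$ is: a constant ($\bot$ or $\top$); a literal $x$ or $\neg x$ with $x\in Y$; or a deterministic NNF $\bigvee_{i\in[m]}(P_i\wedge S_i)$ such that some node $v$ with children $w,w'$ structures every displayed $\wedge$-gate, each $P_i$ is an SDD structured by $T_w$, each $S_i$ is an SDD structured by $T_{w'}$, $\bigvee_iP_i\equiv\top$, and $P_i\wedge P_j\equiv\bot$ for $i\ne j$. It is canonical if moreover (recursively) $S_i\not\equiv S_j$ for all $i\neq j$. Construction: for disjoint $Y,Y'\subseteq X$ and $\mathcal{H}\subseteq\mathsf{factors}(F,Y\cup Y')$, for $G\in\mathsf{factors}(F,Y)$ let $\mathcal{S}_G=\{G': (G,G')\in\mathsf{impl}(F,H,Y,Y'),H\in\mathcal{H}\}$; let $\mathcal{S}_1,\dots,\mathcal{S}_m$ be the distinct sets among the $\mathcal{S}_G$, $\mathcal{P}_i=\{G:\mathcal{S}_G=\mathcal{S}_i\}$, and $\mathsf{sd}(F,\mathcal{H},Y,Y')=\{(\mathcal{P}_i,\mathcal{S}_i):i\in[m]\}$. For $v\in T$ and $\mathcal{H}\subseteq\mathsf{factors}(F,X_v)$ define $C_{v,\mathcal{H}}$: if $v$ is a leaf $x$ with $F(0,X\setminus\{x\})=F(1,X\setminus\{x\})$,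 then $\mathsf{factors}(F,\{x\})=\{H\}$, $C_{v,\emptyset}=\bot$, $C_{v,\{H\}}=\top$; otherwise $\mathsf{factors}(F,\{x\})=\{H_0,H_1\}$ with $\mathsf{sat}(H_c)=\{x\mapsto c\}$ and $C_{v,\emptyset}=\bot$, $C_{v,\{H_0\}}=\neg x$, $C_{v,\{H_1\}}=x$, $C_{v,\{H_0,H_1\}}=\top$. If $v$ has children $w,w'$: $C_{v,\mathcal{H}}=\bigvee_{(\mathcal{P},\mathcal{S})\in\mathsf{sd}(F,\mathcal{H},X_w,X_{w'})}(C_{w,\mathcal{P}}\wedge C_{w',\mathcal{S}})$. -}

module Defs where

open import Level using (0ℓ)
open import Data.Bool using (Bool; true; false; if_then_else_; not)
open import Data.Nat using (ℕ; zero; suc)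
open import Data.Fin using (Fin)
import Data.Fin as Fin
open import Data.Fin.Subset using (Subset; ⁅_⁆) renaming (_∈_ to _∈ₛ_; _∪_ to _∪ₛ_)
open import Data.Vec using (Vec; []; _∷_; lookup; _[_]≔_)
open import Data.List using (List; []; _∷_)
import Data.List as List
open import Data.Product using (Σ; _×_; _,_; ∃)
open import Data.Unit using (⊤)
open import Relation.Nullary using (¬_; does)
open import Relation.Binary.PropositionalEquality using (_≡_; _≢_)
open import Relation.Unary using (Pred; _⊆_; _≐_; ∅; ｛_｝) renaming (_∪_ to _∪ᵤ_)
open import Function.Bundles using (_⇔_)

-- Variables are Fin n; the variable set X of F is all of Fin n.
-- Total assignments of X.

Assign : ℕ → Set
Assign n = Vec Bool n

-- Boolean functions {0,1}^X → {0,1}, represented by truth tables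
-- (Shannon expansion on the first variable), so that _≡_ on TT n is
-- exactly extensional equality of Boolean functions.

TT : ℕ → Set
TT zero    = Bool
TT (suc n) = TT n × TT n

infix 20 _⟦_⟧
_⟦_⟧ : ∀ {n} → TT n → Assign n → Bool
_⟦_⟧ {zero}  b         []      = b
_⟦_⟧ {suc n} (t₀ , t₁) (x ∷ a) = if x then t₁ ⟦ a ⟧ else t₀ ⟦ a ⟧

tab : ∀ {n} → (Assign n → Bool) → TT n
tab {zero}  f = f []
tab {suc n} f = tab (λ a → f (false ∷ a)) , tab (λ a → f (true ∷ a))

merge : ∀ {n} → Subset n → Assign n → Assign n → Assign n
merge []      []      []        = []
merge (y ∷ Y) (b ∷ a) (b' ∷ a') = (if y then b else b') ∷ merge Y a a'

SameCofactor : ∀ {n} → TT n → Subset n → Assign n → Assign n → Set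
SameCofactor F Y a a₀ = ∀ a' → F ⟦ merge Y a a' ⟧ ≡ F ⟦ merge Y a₀ a' ⟧

-- G is a factor of F relative to Y.  A function on {0,1}^Y is
-- represented by a function on {0,1}^X; the defining condition forces it
-- to depend only on the variables of Y.
IsFactor : ∀ {n} → TT n → Subset n → TT n → Set
IsFactor F Y G = ∃ λ a₀ → ∀ a → (G ⟦ a ⟧ ≡ true ⇔ SameCofactor F Y a a₀)

Factors : ∀ {n} → TT n → Subset n → Pred (TT n) 0ℓ
Factors F Y = IsFactor F Y

Impl : ∀ {n} → TT n → TT n → Subset n → Subset n → TT n → TT n → Set
Impl F H Y Y' G G' =
  IsFactor F Y G × IsFactor F Y' G' ×
  (∀ a a' → G ⟦ a ⟧ ≡ true → G' ⟦ a' ⟧ ≡ true → H ⟦ merge Y a a' ⟧ ≡ true)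

SG : ∀ {n} → TT n → Pred (TT n) 0ℓ → Subset n → Subset n → TT n → Pred (TT n) 0ℓ
SG F 𝓗 Y Y' G G' = ∃ λ H → 𝓗 H × Impl F H Y Y' G G'

InSD : ∀ {n} → TT n → Pred (TT n) 0ℓ → Subset n → Subset n →
       Pred (TT n) 0ℓ → Pred (TT n) 0ℓ → Set
InSD F 𝓗 Y Y' 𝓟 𝓢 =
  (∃ λ G → IsFactor F Y G × 𝓢 ≐ SG F 𝓗 Y Y' G) ×
  (𝓟 ≐ λ G → IsFactor F Y G × SG F 𝓗 Y Y' G ≐ 𝓢)

-- Circuits (as formulas; sharing is irrelevant for the statement)

data Circ (n : ℕ) : Set where
  var   : Fin n → Circ n
  const : Bool → Circ n
  neg   : Circ n → Circ n
  and   : List (Circ n) → Circ n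
  or    : List (Circ n) → Circ n

mutual
  eval : ∀ {n} → Circ n → Assign n → Bool
  eval (var x)   a = lookup a x
  eval (const b) a = b
  eval (neg c)   a = not (eval c a)
  eval (and cs)  a = evalAnd cs a
  eval (or cs)   a = evalOr cs a

  evalAnd : ∀ {n} → List (Circ n) → Assign n → Bool
  evalAnd []       a = true
  evalAnd (c ∷ cs) a = if eval c a then evalAnd cs a else false

  evalOr : ∀ {n} → List (Circ n) → Assign n → Bool
  evalOr []       a = false
  evalOr (c ∷ cs) a = if eval c a then true else evalOr cs a

mutual
  VarsIn : ∀ {n} → Circ n → Subset n → Set
  VarsIn (var x)   Y = x ∈ₛ Y
  VarsIn (const b) Y = ⊤
  VarsIn (neg c)   Y = VarsIn c Y
  VarsIn (and cs)  Y = AllVarsIn cs Y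
  VarsIn (or cs)   Y = AllVarsIn cs Y

  AllVarsIn : ∀ {n} → List (Circ n) → Subset n → Set
  AllVarsIn []       Y = ⊤
  AllVarsIn (c ∷ cs) Y = VarsIn c Y × AllVarsIn cs Y

Computes : ∀ {n} → Circ n → Pred (TT n) 0ℓ → Set
Computes C 𝓗 = ∀ a → (eval C a ≡ true ⇔ ∃ λ H → 𝓗 H × H ⟦ a ⟧ ≡ true)

-- Vtrees: every internal node has exactly two (ordered) children.
-- Nodes v of T are identified with the subtrees T_v.

data VTree (n : ℕ) : Set where
  leaf : Fin n → VTree n
  node : VTree n → VTree n → VTree n

leaves : ∀ {n} → VTree n → Subset n
leaves (leaf x)   = ⁅ x ⁆
leaves (node l r) = leaves l ∪ₛ leaves r

count : ∀ {n} → Fin n → VTree n → ℕ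
count x (leaf y)   = if does (x Fin.≟ y) then 1 else 0
count x (node l r) = count x l Data.Nat.+ count x r

IsVtreeFor : ∀ {n} → VTree n → Set
IsVtreeFor T = ∀ x → count x T ≡ 1

data _≼_ {n} : VTree n → VTree n → Set where
  here  : ∀ {T} → T ≼ T
  left  : ∀ {v l r} → v ≼ l → v ≼ node l r
  right : ∀ {v l r} → v ≼ r → v ≼ node l r

-- SDDs.  The flag c = true adds the canonicity condition (recursively).

IfCanon : Bool → Set → Set
IfCanon true  A = A
IfCanon false A = ⊤

decomp : ∀ {n} (m : ℕ) → (Fin m → Circ n) → (Fin m → Circ n) → Circ n
decomp m P S = or (List.tabulate {n = m} λ i → and (P i ∷ S i ∷ []))

data SDD {n} (c : Bool) : VTree n → Circ n → Set where
  const : ∀ {T} b → SDD c T (const b)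
  pos   : ∀ {T x} → x ∈ₛ leaves T → SDD c T (var x)
  negl  : ∀ {T x} → x ∈ₛ leaves T → SDD c T (neg (var x))
  dec   : ∀ {T l r} → node l r ≼ T →
          (m : ℕ) (P S : Fin m → Circ n) →
          (∀ i → SDD c l (P i)) →
          (∀ i → SDD c r (S i)) →
          (∀ i → VarsIn (P i) (leaves l)) →
          (∀ i → VarsIn (S i) (leaves r)) →
          (∀ i j → i ≢ j → ∀ a →
             eval (and (P i ∷ S i ∷ [])) a ≡ true →
             eval (and (P j ∷ S j ∷ [])) a ≡ false) →
          (∀ a → ∃ λ i → eval (P i) a ≡ true) →
          (∀ i j → i ≢ j → ∀ a → eval (P i) a ≡ true → eval (P j) a ≡ false) →
          IfCanon c (∀ i j → i ≢ j → ¬ (∀ a → eval (S i) a ≡ eval (S j) a)) →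
          SDD c T (decomp m P S)

IsSDD : ∀ {n} → VTree n → Circ n → Set
IsSDD = SDD false

CanonicalSDD : ∀ {n} → VTree n → Circ n → Set
CanonicalSDD = SDD true

-- The construction C_{v,𝓗}, as the relation IsC F v 𝓗 C
-- ("C is C_{v,𝓗}"); the order of the disjuncts over the set sd is free.

Indep : ∀ {n} → TT n → Fin n → Set
Indep F x = ∀ a → F ⟦ a [ x ]≔ false ⟧ ≡ F ⟦ a [ x ]≔ true ⟧

litFn : ∀ {n} → Fin n → Bool → TT n
litFn x c = tab (λ a → if c then lookup a x else not (lookup a x))

data IsC {n} (F : TT n) : VTree n → Pred (TT n) 0ℓ → Circ n → Set₁ where
  indep-∅   : ∀ {x 𝓗} → Indep F x → 𝓗 ≐ ∅ → IsC F (leaf x) 𝓗 (const false)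
  indep-H   : ∀ {x 𝓗} → Indep F x → 𝓗 ≐ Factors F ⁅ x ⁆ →
              IsC F (leaf x) 𝓗 (const true)
  dep-∅     : ∀ {x 𝓗} → ¬ Indep F x → 𝓗 ≐ ∅ → IsC F (leaf x) 𝓗 (const false)
  dep-H₀    : ∀ {x 𝓗} → ¬ Indep F x → 𝓗 ≐ ｛ litFn x false ｝ →
              IsC F (leaf x) 𝓗 (neg (var x))
  dep-H₁    : ∀ {x 𝓗} → ¬ Indep F x → 𝓗 ≐ ｛ litFn x true ｝ →
              IsC F (leaf x) 𝓗 (var x)
  dep-H₀H₁  : ∀ {x 𝓗} → ¬ Indep F x →
              𝓗 ≐ (｛ litFn x false ｝ ∪ᵤ ｛ litFn x true ｝) →
              IsC F (leaf x) 𝓗 (const true)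
  node      : ∀ {l r 𝓗} (m : ℕ) (𝓟 𝓢 : Fin m → Pred (TT n) 0ℓ)
              (P S : Fin m → Circ n) →
              (∀ i → InSD F 𝓗 (leaves l) (leaves r) (𝓟 i) (𝓢 i)) →
              (∀ 𝓟' 𝓢' → InSD F 𝓗 (leaves l) (leaves r) 𝓟' 𝓢' →
                 ∃ λ i → 𝓟' ≐ 𝓟 i × 𝓢' ≐ 𝓢 i) →
              (∀ i j → i ≢ j → ¬ (𝓢 i ≐ 𝓢 j)) →
              (∀ i → IsC F l (𝓟 i) (P i)) →
              (∀ i → IsC F r (𝓢 i) (S i)) →
              IsC F (node l r) 𝓗 (decomp m P S)

-- At an internal node with children w, w' put Y = X_w and
-- Y' = X_w'.  Every assignment a satisfies exactly one factor relative to Y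
-- (the class of its cofactor), so the primes P_i, which compute the unions of
-- the blocks 𝓟_i of a partition of factors(F, Y), are exhaustive and pairwise
-- exclusive.  Since Y and Y' are disjoint, the cofactor of a relative to
-- Y ∪ Y' is determined by its factors G_a, G'_a relative to Y and Y', so
-- a ⊨ H for H ∈ factors(F, Y ∪ Y') iff (G_a , G'_a) ∈ impl(F, H, Y, Y'); this
-- makes ⋁ (P_i ∧ S_i) compute ⋁ 𝓗.  Finally a set of factors is determined by
-- its disjunction, so distinct 𝓢_i give inequivalent subs S_i.
module Submission where

open import Defs
open import Level using (0ℓ)
open import Data.Nat using (ℕ; zero; suc; _≤_; z≤n; s≤s; _+_)
open import Data.Nat.Properties using (≤-refl; ≤-trans; <-irrefl; m≤m+n; m≤n+m; +-mono-≤; module ≤-Reasoning)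
open import Data.Product using (_×_; _,_; ∃; proj₁; proj₂)
open import Data.Product.Properties using (≡-dec)
open import Data.Sum using (inj₁; inj₂)
open import Data.Empty using (⊥; ⊥-elim)
open import Data.Unit using (tt)
open import Data.Bool using (Bool; true; false; if_then_else_; not; _∨_)
open import Data.Bool.Properties using (⇔→≡; ¬-not; T-≡)
import Data.Bool.Properties as Bool
open import Data.Fin using (Fin)
import Data.Fin as Fin
open import Data.Fin.Subset using (Subset; ⁅_⁆) renaming (_∈_ to _∈ₛ_; _∪_ to _∪ₛ_)
open import Data.Fin.Subset.Properties using (x∈⁅x⁆; x∈⁅y⁆⇒x≡y; x∈p∪q⁻; p⊆p∪q; q⊆p∪q)
open import Data.Vec using ([]; _∷_; lookup; here; there)
open import Data.List using (List; []; _∷_)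
import Data.List as List
open import Data.List.Relation.Unary.Any using (Any; here; there)
open import Data.List.Relation.Unary.Any.Properties using (tabulate⁺; tabulate⁻)
open import Function using (_∘_)
open import Function.Bundles using (_⇔_; mk⇔; Equivalence)
open import Relation.Nullary using (¬_; yes; no)
open import Relation.Nullary.Decidable using (isYes; toWitness; fromWitness)
open import Relation.Binary.Definitions using (DecidableEquality)
open import Relation.Binary.PropositionalEquality
open import Relation.Unary using (Pred; _⊆_; _≐_; ∅; ｛_｝)
open import Relation.Unary.Properties using (≐-refl; ≐-sym; ≐-trans)
open Equivalence

private
  variable
    n : ℕ

tab-⟦⟧ : (f : Assign n → Bool) (a : Assign n) → tab f ⟦ a ⟧ ≡ f a
tab-⟦⟧ {zero}  f []          = refl
tab-⟦⟧ {suc n} f (false ∷ a) = tab-⟦⟧ _ a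
tab-⟦⟧ {suc n} f (true ∷ a)  = tab-⟦⟧ _ a

⟦⟧-injective : {t u : TT n} → (∀ a → t ⟦ a ⟧ ≡ u ⟦ a ⟧) → t ≡ u
⟦⟧-injective {zero}  t≗u = t≗u []
⟦⟧-injective {suc n} t≗u =
  cong₂ _,_ (⟦⟧-injective (t≗u ∘ (false ∷_))) (⟦⟧-injective (t≗u ∘ (true ∷_)))

_≟ᵀ_ : DecidableEquality (TT n)
_≟ᵀ_ {zero}  = Bool._≟_
_≟ᵀ_ {suc n} = ≡-dec _≟ᵀ_ _≟ᵀ_

Disjoint : Subset n → Subset n → Set
Disjoint Y Y' = ∀ x → x ∈ₛ Y → x ∈ₛ Y' → ⊥

merge-idem : (Y : Subset n) (a : Assign n) → merge Y a a ≡ a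
merge-idem []          []      = refl
merge-idem (true ∷ Y)  (b ∷ a) = cong (b ∷_) (merge-idem Y a)
merge-idem (false ∷ Y) (b ∷ a) = cong (b ∷_) (merge-idem Y a)

merge-∪ : (Y Y' : Subset n) (a a' c : Assign n) →
          merge (Y ∪ₛ Y') (merge Y a a') c ≡ merge Y a (merge Y' a' c)
merge-∪ []      []        []      []        []      = refl
merge-∪ (y ∷ Y) (y' ∷ Y') (b ∷ a) (b' ∷ a') (d ∷ c) =
  cong₂ _∷_ (head y y') (merge-∪ Y Y' a a' c)
  where
  head : ∀ y y' → (if y ∨ y' then (if y then b else b') else d)
                ≡ (if y then b else (if y' then b' else d))
  head true  _     = refl
  head false true  = refl
  head false false = refl

merge-comm : (Y Y' : Subset n) → Disjoint Y Y' → (a a' c : Assign n) →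
             merge Y a (merge Y' a' c) ≡ merge Y' a' (merge Y a c)
merge-comm []      []        _    []      []        []      = refl
merge-comm (y ∷ Y) (y' ∷ Y') Y∩Y' (b ∷ a) (b' ∷ a') (d ∷ c) =
  cong₂ _∷_ (head y y' λ { refl refl → Y∩Y' Fin.zero here here })
            (merge-comm Y Y' (λ x x∈Y x∈Y' → Y∩Y' (Fin.suc x) (there x∈Y) (there x∈Y'))
                        a a' c)
  where
  head : ∀ y y' → (y ≡ true → y' ≡ true → ⊥) →
         (if y then b else (if y' then b' else d)) ≡ (if y' then b' else (if y then b else d))
  head true  true  both = ⊥-elim (both refl refl)
  head true  false _    = refl
  head false true  _    = refl
  head false false _    = refl

merge-absorb : (Y Y' : Subset n) (a c : Assign n) →
               merge Y' a (merge Y a c) ≡ merge (Y ∪ₛ Y') a c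
merge-absorb []      []        []      []      = refl
merge-absorb (y ∷ Y) (y' ∷ Y') (b ∷ a) (d ∷ c) =
  cong₂ _∷_ (head y y') (merge-absorb Y Y' a c)
  where
  head : ∀ y y' → (if y' then b else (if y then b else d)) ≡ (if y ∨ y' then b else d)
  head true  true  = refl
  head true  false = refl
  head false true  = refl
  head false false = refl

module _ (F : TT n) (Y : Subset n) where

  cofactor : Assign n → TT n
  cofactor a = tab (λ a' → F ⟦ merge Y a a' ⟧)

  cofactor-≡⇔ : ∀ {a b} → cofactor a ≡ cofactor b ⇔ SameCofactor F Y a b
  cofactor-≡⇔ = mk⇔
    (λ eq a' → trans (sym (tab-⟦⟧ _ a')) (trans (cong (_⟦ a' ⟧) eq) (tab-⟦⟧ _ a')))
    (λ same → ⟦⟧-injective λ a' →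
                trans (tab-⟦⟧ _ a') (trans (same a') (sym (tab-⟦⟧ _ a'))))

  factorAt : Assign n → TT n
  factorAt a = tab (λ b → isYes (cofactor b ≟ᵀ cofactor a))

  factorAt-⟦⟧ : ∀ {a b} → factorAt a ⟦ b ⟧ ≡ true ⇔ SameCofactor F Y b a
  factorAt-⟦⟧ {b = b} = mk⇔
    (λ Gb → to cofactor-≡⇔ (toWitness (from T-≡ (trans (sym (tab-⟦⟧ _ b)) Gb))))
    (λ same → trans (tab-⟦⟧ _ b) (to T-≡ (fromWitness (from cofactor-≡⇔ same))))

  factorAt-isFactor : ∀ a → IsFactor F Y (factorAt a)
  factorAt-isFactor a = a , λ b → factorAt-⟦⟧

  factorAt-self : ∀ a → factorAt a ⟦ a ⟧ ≡ true
  factorAt-self a = from factorAt-⟦⟧ (λ _ → refl)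

  factor-unique : ∀ {G G' a} → IsFactor F Y G → IsFactor F Y G' →
                  G ⟦ a ⟧ ≡ true → G' ⟦ a ⟧ ≡ true → G ≡ G'
  factor-unique {a = a} (_ , G≈) (_ , G'≈) Ga G'a =
    ⟦⟧-injective λ b → ⇔→≡ (mk⇔ (move G≈ G'≈ Ga G'a) (move G'≈ G≈ G'a Ga))
    where
    move : ∀ {K K' k₀ k₀'} →
           (∀ b → K ⟦ b ⟧ ≡ true ⇔ SameCofactor F Y b k₀) →
           (∀ b → K' ⟦ b ⟧ ≡ true ⇔ SameCofactor F Y b k₀') →
           K ⟦ a ⟧ ≡ true → K' ⟦ a ⟧ ≡ true → ∀ {b} → K ⟦ b ⟧ ≡ true → K' ⟦ b ⟧ ≡ true
    move K≈ K'≈ Ka K'a {b} Kb = from (K'≈ b) λ c →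
      trans (to (K≈ b) Kb c) (trans (sym (to (K≈ a) Ka c)) (to (K'≈ a) K'a c))

  factor-satisfiable : ∀ {G} → IsFactor F Y G → ∃ λ a → G ⟦ a ⟧ ≡ true
  factor-satisfiable (a₀ , G≈) = a₀ , from (G≈ a₀) (λ _ → refl)

-- The cofactor of a relative to Y ∪ Y' is determined by its factors
-- relative to the disjoint sets Y and Y'.
factorAt-impl : (F : TT n) (Y Y' : Subset n) → Disjoint Y Y' → ∀ {H} a →
                IsFactor F (Y ∪ₛ Y') H → H ⟦ a ⟧ ≡ true →
                Impl F H Y Y' (factorAt F Y a) (factorAt F Y' a)
factorAt-impl F Y Y' Y∩Y' a (_ , H≈) Ha =
  factorAt-isFactor F Y a , factorAt-isFactor F Y' a ,
  λ b b' Gb G'b' → from (H≈ (merge Y b b')) λ c →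
    trans (same b b' Gb G'b' c) (to (H≈ a) Ha c)
  where
  open ≡-Reasoning
  same : ∀ b b' → factorAt F Y a ⟦ b ⟧ ≡ true → factorAt F Y' a ⟦ b' ⟧ ≡ true →
         SameCofactor F (Y ∪ₛ Y') (merge Y b b') a
  same b b' Gb G'b' c = begin
    F ⟦ merge (Y ∪ₛ Y') (merge Y b b') c ⟧ ≡⟨ cong (F ⟦_⟧) (merge-∪ Y Y' b b' c) ⟩
    F ⟦ merge Y b (merge Y' b' c) ⟧        ≡⟨ to (factorAt-⟦⟧ F Y) Gb (merge Y' b' c) ⟩
    F ⟦ merge Y a (merge Y' b' c) ⟧        ≡⟨ cong (F ⟦_⟧) (merge-comm Y Y' Y∩Y' a b' c) ⟩
    F ⟦ merge Y' b' (merge Y a c) ⟧        ≡⟨ to (factorAt-⟦⟧ F Y') G'b' (merge Y a c) ⟩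
    F ⟦ merge Y' a (merge Y a c) ⟧         ≡⟨ cong (F ⟦_⟧) (merge-absorb Y Y' a c) ⟩
    F ⟦ merge (Y ∪ₛ Y') a c ⟧              ∎

evalOr⁺ : ∀ (cs : List (Circ n)) a → Any (λ c → eval c a ≡ true) cs → evalOr cs a ≡ true
evalOr⁺ (c ∷ cs) a (here ca) rewrite ca = refl
evalOr⁺ (c ∷ cs) a (there q) with eval c a
... | true  = refl
... | false = evalOr⁺ cs a q

evalOr⁻ : ∀ (cs : List (Circ n)) a → evalOr cs a ≡ true → Any (λ c → eval c a ≡ true) cs
evalOr⁻ (c ∷ cs) a e with eval c a in ca
... | true  = here ca
... | false = there (evalOr⁻ cs a e)

eval-and₂ : ∀ (p s : Circ n) a →
            eval (and (p ∷ s ∷ [])) a ≡ true ⇔ (eval p a ≡ true × eval s a ≡ true)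
eval-and₂ p s a with eval p a | eval s a
... | true  | true  = mk⇔ (λ _ → refl , refl) (λ _ → refl)
... | true  | false = mk⇔ (λ ()) (λ ())
... | false | _     = mk⇔ (λ ()) (λ ())

eval-and₂-false : ∀ (p s : Circ n) a → eval p a ≡ false → eval (and (p ∷ s ∷ [])) a ≡ false
eval-and₂-false p s a pa rewrite pa = refl

eval-decomp : ∀ m (P S : Fin m → Circ n) a →
              eval (decomp m P S) a ≡ true ⇔ (∃ λ i → eval (P i) a ≡ true × eval (S i) a ≡ true)
eval-decomp m P S a = mk⇔
  (λ e → let i , PSa = tabulate⁻ (evalOr⁻ _ a e) in i , to (eval-and₂ (P i) (S i) a) PSa)
  (λ (i , PSa) → evalOr⁺ _ a (tabulate⁺ i (from (eval-and₂ (P i) (S i) a) PSa)))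

computes-⊥ : {𝓗 : Pred (TT n) 0ℓ} → 𝓗 ≐ ∅ → Computes (const false) 𝓗
computes-⊥ 𝓗≐∅ a = mk⇔ (λ ()) (λ (H , H∈𝓗 , _) → ⊥-elim (proj₁ 𝓗≐∅ H∈𝓗))

computes-⊤ : {𝓗 : Pred (TT n) 0ℓ} → (∀ a → ∃ λ H → 𝓗 H × H ⟦ a ⟧ ≡ true) →
             Computes (const true) 𝓗
computes-⊤ covered a = mk⇔ (λ _ → covered a) (λ _ → refl)

computes-｛｝ : ∀ (C : Circ n) {H 𝓗} → (∀ a → eval C a ≡ H ⟦ a ⟧) → 𝓗 ≐ ｛ H ｝ →
               Computes C 𝓗
computes-｛｝ C {H} C≗H 𝓗≐H a = mk⇔
  (λ Ca → H , proj₂ 𝓗≐H refl , trans (sym (C≗H a)) Ca)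
  (λ { (H' , H'∈𝓗 , H'a) →
        trans (C≗H a) (subst (λ K → K ⟦ a ⟧ ≡ true) (sym (proj₁ 𝓗≐H H'∈𝓗)) H'a) })

computes-factors-⊆ : ∀ {F : TT n} {Y} (C C' : Circ n) {𝓐 𝓑 : Pred (TT n) 0ℓ} →
                     𝓐 ⊆ Factors F Y → 𝓑 ⊆ Factors F Y →
                     Computes C 𝓐 → Computes C' 𝓑 → (∀ a → eval C a ≡ eval C' a) → 𝓐 ⊆ 𝓑
computes-factors-⊆ {F = F} {Y} C C' {𝓑 = 𝓑} 𝓐⊆ 𝓑⊆ C≈𝓐 C'≈𝓑 C≗C' {G} G∈𝓐 =
  let a , Ga = factor-satisfiable F Y (𝓐⊆ G∈𝓐)
      G' , G'∈𝓑 , G'a = to (C'≈𝓑 a) (trans (sym (C≗C' a)) (from (C≈𝓐 a) (G , G∈𝓐 , Ga)))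
  in subst 𝓑 (factor-unique F Y (𝓑⊆ G'∈𝓑) (𝓐⊆ G∈𝓐) G'a Ga) G'∈𝓑

mutual
  VarsIn-mono : ∀ {Y Y' : Subset n} → (∀ {x} → x ∈ₛ Y → x ∈ₛ Y') →
                ∀ C → VarsIn C Y → VarsIn C Y'
  VarsIn-mono Y⊆Y' (var x)   x∈Y = Y⊆Y' x∈Y
  VarsIn-mono Y⊆Y' (const b) _   = tt
  VarsIn-mono Y⊆Y' (neg c)   c⊆Y = VarsIn-mono Y⊆Y' c c⊆Y
  VarsIn-mono Y⊆Y' (and cs)  cs⊆Y = AllVarsIn-mono Y⊆Y' cs cs⊆Y
  VarsIn-mono Y⊆Y' (or cs)   cs⊆Y = AllVarsIn-mono Y⊆Y' cs cs⊆Y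

  AllVarsIn-mono : ∀ {Y Y' : Subset n} → (∀ {x} → x ∈ₛ Y → x ∈ₛ Y') →
                   ∀ cs → AllVarsIn cs Y → AllVarsIn cs Y'
  AllVarsIn-mono Y⊆Y' []       _                = tt
  AllVarsIn-mono Y⊆Y' (c ∷ cs) (c⊆Y , cs⊆Y) =
    VarsIn-mono Y⊆Y' c c⊆Y , AllVarsIn-mono Y⊆Y' cs cs⊆Y

AllVarsIn-tabulate : ∀ m (f : Fin m → Circ n) Y → (∀ i → VarsIn (f i) Y) →
                     AllVarsIn (List.tabulate f) Y
AllVarsIn-tabulate zero    f Y _   = tt
AllVarsIn-tabulate (suc m) f Y f⊆Y =
  f⊆Y Fin.zero , AllVarsIn-tabulate m (f ∘ Fin.suc) Y (f⊆Y ∘ Fin.suc)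

IsC-VarsIn : ∀ {F : TT n} {v 𝓗 C} → IsC F v 𝓗 C → VarsIn C (leaves v)
IsC-VarsIn (indep-∅ _ _)  = tt
IsC-VarsIn (indep-H _ _)  = tt
IsC-VarsIn (dep-∅ _ _)    = tt
IsC-VarsIn {v = leaf x} (dep-H₀ _ _) = x∈⁅x⁆ x
IsC-VarsIn {v = leaf x} (dep-H₁ _ _) = x∈⁅x⁆ x
IsC-VarsIn (dep-H₀H₁ _ _) = tt
IsC-VarsIn {v = node l r} (node m _ _ P S _ _ _ cP cS) = AllVarsIn-tabulate m _ _ λ i →
  VarsIn-mono (p⊆p∪q (leaves r)) (P i) (IsC-VarsIn (cP i)) ,
  VarsIn-mono (q⊆p∪q (leaves l) (leaves r)) (S i) (IsC-VarsIn (cS i)) , tt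

≼-left : {l r T : VTree n} → node l r ≼ T → l ≼ T
≼-left here      = left here
≼-left (left p)  = left (≼-left p)
≼-left (right p) = right (≼-left p)

≼-right : {l r T : VTree n} → node l r ≼ T → r ≼ T
≼-right here      = right here
≼-right (left p)  = left (≼-right p)
≼-right (right p) = right (≼-right p)

count-mono : ∀ x {v T : VTree n} → v ≼ T → count x v ≤ count x T
count-mono x here = ≤-refl
count-mono x {T = node l r} (left p)  = ≤-trans (count-mono x p) (m≤m+n (count x l) (count x r))
count-mono x {T = node l r} (right p) = ≤-trans (count-mono x p) (m≤n+m (count x r) (count x l))

∈-leaves⇒count-pos : ∀ x (t : VTree n) → x ∈ₛ leaves t → 1 ≤ count x t
∈-leaves⇒count-pos x (leaf y) x∈ with x Fin.≟ y
... | yes _   = s≤s z≤n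
... | no x≢y  = ⊥-elim (x≢y (x∈⁅y⁆⇒x≡y y x∈))
∈-leaves⇒count-pos x (node l r) x∈ with x∈p∪q⁻ (leaves l) (leaves r) x∈
... | inj₁ x∈l = ≤-trans (∈-leaves⇒count-pos x l x∈l) (m≤m+n (count x l) (count x r))
... | inj₂ x∈r = ≤-trans (∈-leaves⇒count-pos x r x∈r) (m≤n+m (count x r) (count x l))

children-disjoint : {T l r : VTree n} → IsVtreeFor T → node l r ≼ T →
                    Disjoint (leaves l) (leaves r)
children-disjoint {T = T} {l} {r} T-vtree p x x∈l x∈r = <-irrefl refl (begin
  2                     ≤⟨ +-mono-≤ (∈-leaves⇒count-pos x l x∈l) (∈-leaves⇒count-pos x r x∈r) ⟩
  count x l + count x r ≤⟨ count-mono x p ⟩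
  count x T             ≡⟨ T-vtree x ⟩
  1                     ∎)
  where open ≤-Reasoning

module _ {F : TT n} {𝓗 : Pred (TT n) 0ℓ} {Y Y' : Subset n} {𝓟 𝓢 : Pred (TT n) 0ℓ}
         (𝓟𝓢∈sd : InSD F 𝓗 Y Y' 𝓟 𝓢) where

  InSD-prime-factor : 𝓟 ⊆ Factors F Y
  InSD-prime-factor G∈𝓟 = proj₁ (proj₁ (proj₂ 𝓟𝓢∈sd) G∈𝓟)

  InSD-prime-SG : ∀ {G} → 𝓟 G → SG F 𝓗 Y Y' G ≐ 𝓢
  InSD-prime-SG G∈𝓟 = proj₂ (proj₁ (proj₂ 𝓟𝓢∈sd) G∈𝓟)

  InSD-sub-factor : 𝓢 ⊆ Factors F Y'
  InSD-sub-factor G'∈𝓢 with proj₁ 𝓟𝓢∈sd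
  ... | _ , _ , 𝓢≐SG = proj₁ (proj₂ (proj₂ (proj₂ (proj₁ 𝓢≐SG G'∈𝓢))))

module Decomposition
  {F : TT n} {𝓗 : Pred (TT n) 0ℓ} {l r : VTree n} {m : ℕ}
  {𝓟 𝓢 : Fin m → Pred (TT n) 0ℓ} {P S : Fin m → Circ n}
  (sd : ∀ i → InSD F 𝓗 (leaves l) (leaves r) (𝓟 i) (𝓢 i))
  (complete : ∀ 𝓟' 𝓢' → InSD F 𝓗 (leaves l) (leaves r) 𝓟' 𝓢' →
                ∃ λ i → 𝓟' ≐ 𝓟 i × 𝓢' ≐ 𝓢 i)
  (distinct : ∀ i j → i ≢ j → ¬ (𝓢 i ≐ 𝓢 j))
  (P-computes : ∀ i → Computes (P i) (𝓟 i))
  (S-computes : ∀ i → Computes (S i) (𝓢 i))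
  where

  private
    Y Y' : Subset n
    Y  = leaves l
    Y' = leaves r

  factorAt-prime : ∀ a → ∃ λ i → 𝓟 i (factorAt F Y a) × SG F 𝓗 Y Y' (factorAt F Y a) ≐ 𝓢 i
  factorAt-prime a =
    let i , 𝓟ₐ≐𝓟ᵢ , 𝓢ₐ≐𝓢ᵢ =
          complete _ _ ((factorAt F Y a , factorAt-isFactor F Y a , ≐-refl) , ≐-refl)
    in i , proj₁ 𝓟ₐ≐𝓟ᵢ (factorAt-isFactor F Y a , ≐-refl) , 𝓢ₐ≐𝓢ᵢ

  primes-exhaustive : ∀ a → ∃ λ i → eval (P i) a ≡ true
  primes-exhaustive a =
    let i , G∈𝓟ᵢ , _ = factorAt-prime a
    in i , from (P-computes i a) (factorAt F Y a , G∈𝓟ᵢ , factorAt-self F Y a)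

  subs-equal-on-overlap : ∀ i j a → eval (P i) a ≡ true → eval (P j) a ≡ true → 𝓢 i ≐ 𝓢 j
  subs-equal-on-overlap i j a Pᵢa Pⱼa =
    let G  , G∈𝓟ᵢ  , Ga  = to (P-computes i a) Pᵢa
        G' , G'∈𝓟ⱼ , G'a = to (P-computes j a) Pⱼa
        G≡G' = factor-unique F Y (InSD-prime-factor (sd i) G∈𝓟ᵢ)
                                 (InSD-prime-factor (sd j) G'∈𝓟ⱼ) Ga G'a
    in ≐-trans (≐-sym (InSD-prime-SG (sd i) G∈𝓟ᵢ))
               (subst (λ K → SG F 𝓗 Y Y' K ≐ 𝓢 j) (sym G≡G') (InSD-prime-SG (sd j) G'∈𝓟ⱼ))

  primes-exclusive : ∀ i j → i ≢ j → ∀ a → eval (P i) a ≡ true → eval (P j) a ≡ false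
  primes-exclusive i j i≢j a Pᵢa =
    ¬-not λ Pⱼa → distinct i j i≢j (subs-equal-on-overlap i j a Pᵢa Pⱼa)

  elements-exclusive : ∀ i j → i ≢ j → ∀ a →
                       eval (and (P i ∷ S i ∷ [])) a ≡ true →
                       eval (and (P j ∷ S j ∷ [])) a ≡ false
  elements-exclusive i j i≢j a PSᵢa = eval-and₂-false (P j) (S j) a
    (primes-exclusive i j i≢j a (proj₁ (to (eval-and₂ (P i) (S i) a) PSᵢa)))

  subs-⊆ : ∀ i j → (∀ a → eval (S i) a ≡ eval (S j) a) → 𝓢 i ⊆ 𝓢 j
  subs-⊆ i j = computes-factors-⊆ (S i) (S j) (InSD-sub-factor (sd i)) (InSD-sub-factor (sd j))
                                  (S-computes i) (S-computes j)

  subs-distinct : ∀ i j → i ≢ j → ¬ (∀ a → eval (S i) a ≡ eval (S j) a)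
  subs-distinct i j i≢j Sᵢ≗Sⱼ = distinct i j i≢j (subs-⊆ i j Sᵢ≗Sⱼ , subs-⊆ j i (sym ∘ Sᵢ≗Sⱼ))

  decomp-canonical : (∀ i → CanonicalSDD l (P i)) → (∀ i → CanonicalSDD r (S i)) →
                     (∀ i → VarsIn (P i) Y) → (∀ i → VarsIn (S i) Y') →
                     CanonicalSDD (node l r) (decomp m P S)
  decomp-canonical P-sdd S-sdd P⊆Y S⊆Y' =
    dec here m P S P-sdd S-sdd P⊆Y S⊆Y'
        elements-exclusive primes-exhaustive primes-exclusive subs-distinct

  decomp-computes : Disjoint Y Y' → 𝓗 ⊆ Factors F (Y ∪ₛ Y') → Computes (decomp m P S) 𝓗
  decomp-computes Y∩Y' 𝓗⊆ a = mk⇔ sound complete′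
    where
    sound : eval (decomp m P S) a ≡ true → ∃ λ H → 𝓗 H × H ⟦ a ⟧ ≡ true
    sound e =
      let i , Pᵢa , Sᵢa     = to (eval-decomp m P S a) e
          G  , G∈𝓟ᵢ  , Ga  = to (P-computes i a) Pᵢa
          G' , G'∈𝓢ᵢ , G'a = to (S-computes i a) Sᵢa
          H , H∈𝓗 , _ , _ , GG'⊨H = proj₂ (InSD-prime-SG (sd i) G∈𝓟ᵢ) G'∈𝓢ᵢ
      in H , H∈𝓗 , subst (λ b → H ⟦ b ⟧ ≡ true) (merge-idem Y a) (GG'⊨H a a Ga G'a)

    complete′ : (∃ λ H → 𝓗 H × H ⟦ a ⟧ ≡ true) → eval (decomp m P S) a ≡ true
    complete′ (H , H∈𝓗 , Ha) =
      let i , G∈𝓟ᵢ , SGₐ≐𝓢ᵢ = factorAt-prime a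
          G'∈𝓢ᵢ = proj₁ SGₐ≐𝓢ᵢ (H , H∈𝓗 , factorAt-impl F Y Y' Y∩Y' a (𝓗⊆ H∈𝓗) Ha)
      in from (eval-decomp m P S a)
           ( i
           , from (P-computes i a) (factorAt F Y a , G∈𝓟ᵢ , factorAt-self F Y a)
           , from (S-computes i a) (factorAt F Y' a , G'∈𝓢ᵢ , factorAt-self F Y' a))

leaf-correct : ∀ {F : TT n} {x 𝓗 C} → IsC F (leaf x) 𝓗 C →
               CanonicalSDD (leaf x) C × Computes C 𝓗
leaf-correct (indep-∅ _ 𝓗≐∅) = const false , computes-⊥ 𝓗≐∅
leaf-correct (dep-∅ _ 𝓗≐∅)   = const false , computes-⊥ 𝓗≐∅
leaf-correct {F = F} {x} (indep-H _ 𝓗≐factors) = const true , computes-⊤ λ a →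
  factorAt F ⁅ x ⁆ a , proj₂ 𝓗≐factors (factorAt-isFactor F ⁅ x ⁆ a) , factorAt-self F ⁅ x ⁆ a
leaf-correct {x = x} (dep-H₀ _ 𝓗≐H₀) =
  negl (x∈⁅x⁆ x) , computes-｛｝ (neg (var x)) (sym ∘ tab-⟦⟧ _) 𝓗≐H₀
leaf-correct {x = x} (dep-H₁ _ 𝓗≐H₁) =
  pos (x∈⁅x⁆ x) , computes-｛｝ (var x) (sym ∘ tab-⟦⟧ _) 𝓗≐H₁
leaf-correct {x = x} (dep-H₀H₁ _ 𝓗≐H₀H₁) = const true , computes-⊤ literal
  where
  literal : ∀ a → ∃ λ H → _ × H ⟦ a ⟧ ≡ true
  literal a with lookup a x in xa
  ... | true  = litFn x true  , proj₂ 𝓗≐H₀H₁ (inj₂ refl) , trans (tab-⟦⟧ _ a) xa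
  ... | false = litFn x false , proj₂ 𝓗≐H₀H₁ (inj₁ refl) , trans (tab-⟦⟧ _ a) (cong not xa)

lemma6 : ∀ {n : ℕ} (F : TT n) (T : VTree n) → IsVtreeFor T →
         (v : VTree n) → v ≼ T →
         (𝓗 : Pred (TT n) 0ℓ) → 𝓗 ⊆ Factors F (leaves v) →
         (C : Circ n) → IsC F v 𝓗 C →
         CanonicalSDD v C × Computes C 𝓗
lemma6 _ _ _ (leaf _) _ _ _ _ isC = leaf-correct isC
lemma6 F T T-vtree (node l r) p 𝓗 𝓗⊆ _ (node m 𝓟 𝓢 P S sd complete distinct isCᴾ isCˢ) =
  decomp-canonical (proj₁ ∘ IHᴾ) (proj₁ ∘ IHˢ) (IsC-VarsIn ∘ isCᴾ) (IsC-VarsIn ∘ isCˢ) ,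
  decomp-computes (children-disjoint T-vtree p) 𝓗⊆
  where
  IHᴾ : ∀ i → CanonicalSDD l (P i) × Computes (P i) (𝓟 i)
  IHᴾ i = lemma6 F T T-vtree l (≼-left p) (𝓟 i) (InSD-prime-factor (sd i)) (P i) (isCᴾ i)
  IHˢ : ∀ i → CanonicalSDD r (S i) × Computes (S i) (𝓢 i)
  IHˢ i = lemma6 F T T-vtree r (≼-right p) (𝓢 i) (InSD-sub-factor (sd i)) (S i) (isCˢ i)
  open Decomposition {l = l} {r} {P = P} {S} sd complete distinct (proj₂ ∘ IHᴾ) (proj₂ ∘ IHˢ)
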